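{- Let $R_0$ be the graph obtained from $K_4$ by replacing each of its four vertices by a triangle via $Y\rightarrow\triangle$-operations. Then $R_0$ has no forcing edge. Moreover, every graph having $R_0$ as a base has no forcing edge.
   Context: A $Y\rightarrow\triangle$-operation on a degree-3 vertex $x$ with neighbours $y_1,y_2,y_3$ replaces $x$ by a triangle $x_1x_2x_3x_1$ and joins $x_i$ to $y_i$. Thus $R_0$ is the 12-vertex cubic graph consisting of four vertex-disjoint triangles, each pair of which is joined by exactly one edge, every vertex lying on exactly one such joining edge. A graph $H$ is a base of $G$ if $G$ is obtained from $H$ by a nonempty series of $Y\rightarrow\triangle$-operations. An edge is forcing if it lies in exactly one perfect matching. -}

module Defs where

open import Data.Bool using (Bool; true; false; _∧_; _∨_; not)
open import Data.Nat using (ℕ)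
open import Data.Fin using (Fin; remQuot; punchIn; _≟_)
open import Data.Fin.Properties using (all?)
open import Data.Product using (Σ; ∃; _×_; _,_; proj₁; proj₂)
open import Data.Sum using (_⊎_; inj₁; inj₂)
open import Data.Empty using (⊥)
open import Relation.Nullary using (¬_)
open import Relation.Nullary.Decidable using (⌊_⌋; toWitness)
open import Relation.Binary.PropositionalEquality using (_≡_; _≢_)
open import Relation.Binary.Construct.Closure.Transitive using (TransClosure)
open import Function.Bundles using (_↔_; Inverse)
open import Data.Bool.Properties using () renaming (_≟_ to _≟ᵇ_)

record Graph : Set where
  field
    n      : ℕ
    adj    : Fin n → Fin n → Bool
    sym    : ∀ u v → adj u v ≡ adj v u
    irrefl : ∀ u → adj u u ≡ false
open Graph public

record PerfectMatching (G : Graph) (M : Fin (n G) → Fin (n G) → Bool) : Set where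
  field
    M-sym   : ∀ u v → M u v ≡ M v u
    M-edges : ∀ u v → M u v ≡ true → adj G u v ≡ true
    covered : ∀ u → ∃ λ v → M u v ≡ true
    unique  : ∀ u v w → M u v ≡ true → M u w ≡ true → v ≡ w

Forcing : (G : Graph) → Fin (n G) → Fin (n G) → Set
Forcing G u v =
  adj G u v ≡ true ×
  (∃ λ M → PerfectMatching G M × M u v ≡ true) ×
  (∀ M M' → PerfectMatching G M → M u v ≡ true →
            PerfectMatching G M' → M' u v ≡ true →
            ∀ a b → M a b ≡ M' a b)

NoForcingEdge : Graph → Set
NoForcingEdge G = ∀ u v → ¬ Forcing G u v

-- Vertex set after a Y→△-operation at x: V(G) ∖ {x} together with the new
-- triangle x₀ x₁ x₂ (indexed by Fin 3).
YΔVertex : (G : Graph) → Fin (n G) → Set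
YΔVertex G x = (Σ (Fin (n G)) λ v → v ≢ x) ⊎ Fin 3

YΔAdj : (G : Graph) (x : Fin (n G)) (y : Fin 3 → Fin (n G)) →
        YΔVertex G x → YΔVertex G x → Bool
YΔAdj G x y (inj₁ (u , _)) (inj₁ (v , _)) = adj G u v
YΔAdj G x y (inj₂ i)       (inj₂ j)       = not ⌊ i ≟ j ⌋
YΔAdj G x y (inj₁ (u , _)) (inj₂ i)       = ⌊ u ≟ y i ⌋
YΔAdj G x y (inj₂ i)       (inj₁ (u , _)) = ⌊ u ≟ y i ⌋

record YΔStep (G G' : Graph) : Set where
  field
    x         : Fin (n G)
    y         : Fin 3 → Fin (n G)
    y-inj     : ∀ i j → y i ≡ y j → i ≡ j
    y-adj     : ∀ i → adj G x (y i) ≡ true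
    y-all     : ∀ v → adj G x v ≡ true → ∃ λ i → y i ≡ v
    iso       : Fin (n G') ↔ YΔVertex G x
    iso-adj   : ∀ a b → adj G' a b ≡ YΔAdj G x y (Inverse.to iso a) (Inverse.to iso b)

IsBase : Graph → Graph → Set
IsBase H G = TransClosure YΔStep H G

-- R₀: vertex (t , i) ∈ Fin 4 × Fin 3 is the vertex of triangle t joined to
-- triangle s = punchIn t i (the i-th element of Fin 4 ∖ {t}).
R₀adj : Fin 12 → Fin 12 → Bool
R₀adj a b with remQuot {4} 3 a | remQuot {4} 3 b
... | (t , i) | (t' , i') =
  (⌊ t ≟ t' ⌋ ∧ not ⌊ i ≟ i' ⌋) ∨ (⌊ t' ≟ punchIn t i ⌋ ∧ ⌊ t ≟ punchIn t' i' ⌋)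

R₀ : Graph
R₀ = record
  { n = 12
  ; adj = R₀adj
  ; sym = λ u v → toWitness {a? = all? λ u → all? λ v → R₀adj u v ≟ᵇ R₀adj v u} _ u v
  ; irrefl = λ u → toWitness {a? = all? λ u → R₀adj u u ≟ᵇ false} _ u
  }

{-# OPTIONS --safe #-}
module Submission where

-- Every edge of R₀ lies in two different perfect matchings (R₀ has eight of them),
-- and a Y→△ operation at x preserves this: a matching pairing x with y_k lifts to the one
-- pairing y_k with x_k and the other two new vertices with each other.  Different matchings
-- have different lifts, and each edge of the new graph lies in the lift of every matching
-- through a corresponding old edge (x y_i for x_i y_i, x y_k for x_i x_j with
-- {i, j, k} = {0, 1, 2}, and uv for uv).  An edge lying in two different perfect matchings
-- is not forcing.

open import Defs
open import Data.Product using (_×_; ∃; ∃₂; _,_; proj₁; proj₂)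
open import Data.Bool using (Bool; true; false; not)
open import Data.Bool.Properties using () renaming (_≟_ to _≟ᵇ_)
open import Data.Fin using (Fin; zero; suc; #_; _≟_)
open import Data.Fin.Properties using (all?; any?)
open import Data.Vec using (Vec; []; _∷_; lookup)
open import Data.Sum using (inj₁; inj₂)
open import Function using (_∘_)
open import Function.Bundles using (_↔_; _⇔_; Inverse; mk⇔)
open import Relation.Nullary using (Dec; yes; no; ¬_; ¬?; contradiction)
open import Relation.Nullary.Decidable
  using (⌊_⌋; toWitness; _×-dec_; _→-dec_; isYes≗does; dec-true; dec-false; does-⇔)
open import Relation.Binary.PropositionalEquality
  using (_≡_; _≢_; refl; trans; cong; subst; module ≡-Reasoning) renaming (sym to ≡-sym)
open import Relation.Binary.Construct.Closure.Transitive using ([_]; _∷_)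

private
  variable
    A B : Set

isYes-sound : (a? : Dec A) → ⌊ a? ⌋ ≡ true → A
isYes-sound (yes a) _ = a

isYes-complete : (a? : Dec A) → A → ⌊ a? ⌋ ≡ true
isYes-complete a? a = trans (isYes≗does a?) (dec-true a? a)

isYes-incomplete : (a? : Dec A) → ¬ A → ⌊ a? ⌋ ≡ false
isYes-incomplete a? ¬a = trans (isYes≗does a?) (dec-false a? ¬a)

isNo-sound : (a? : Dec A) → not ⌊ a? ⌋ ≡ true → ¬ A
isNo-sound (no ¬a) _ = ¬a

isYes-⇔ : A ⇔ B → (a? : Dec A) (b? : Dec B) → ⌊ a? ⌋ ≡ ⌊ b? ⌋
isYes-⇔ A⇔B a? b? = trans (isYes≗does a?) (trans (does-⇔ A⇔B a? b?) (≡-sym (isYes≗does b?)))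

-- A perfect matching, given by the involution sending each vertex to its partner.
record Pairing {V : Set} (E : V → V → Bool) : Set where
  field
    partner     : V → V
    involutive  : ∀ v → partner (partner v) ≡ v
    along-edges : ∀ v → E v (partner v) ≡ true

  partner-swap : ∀ {u v} → partner u ≡ v → partner v ≡ u
  partner-swap {u} refl = involutive u

open Pairing

_≉_ : {V : Set} {E : V → V → Bool} → Pairing E → Pairing E → Set
P ≉ Q = ∃ λ a → partner P a ≢ partner Q a

≉-away-from : ∀ {n} {E : Fin n → Fin n → Bool} {P Q : Pairing E} x →
              partner P x ≢ x → P ≉ Q → ∃ λ b → b ≢ x × partner P b ≢ partner Q b
≉-away-from {P = P} {Q} x Px≢x (a , Pa≢Qa) with a ≟ x
... | no a≢x = a , a≢x , Pa≢Qa
... | yes refl = partner P a , Px≢x , λ PPa≡QPa →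
  Pa≢Qa (≡-sym (partner-swap Q (trans (≡-sym PPa≡QPa) (involutive P a))))

record InTwoPairings {V : Set} (E : V → V → Bool) (u v : V) : Set where
  field
    P Q  : Pairing E
    P-uv : partner P u ≡ v
    Q-uv : partner Q u ≡ v
    P≉Q  : P ≉ Q

EveryEdgeInTwoPairings : {V : Set} → (V → V → Bool) → Set
EveryEdgeInTwoPairings E = ∀ u v → E u v ≡ true → InTwoPairings E u v

module _ (G : Graph) where

  matchingOf : Pairing (adj G) → Fin (n G) → Fin (n G) → Bool
  matchingOf P u v = ⌊ partner P u ≟ v ⌋

  pairing⇒perfectMatching : (P : Pairing (adj G)) → PerfectMatching G (matchingOf P)
  pairing⇒perfectMatching P = record
    { M-sym   = λ u v → isYes-⇔ (mk⇔ (partner-swap P) (partner-swap P)) _ _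
    ; M-edges = λ u v Pu≡v → subst (λ w → adj G u w ≡ true) (isYes-sound _ Pu≡v) (along-edges P u)
    ; covered = λ u → partner P u , isYes-complete _ refl
    ; unique  = λ u v w Pu≡v Pu≡w → trans (≡-sym (isYes-sound _ Pu≡v)) (isYes-sound _ Pu≡w)
    }

  partner-≢ : (P : Pairing (adj G)) → ∀ v → partner P v ≢ v
  partner-≢ P v Pv≡v =
    contradiction (trans (≡-sym (along-edges P v)) (trans (cong (adj G v) Pv≡v) (irrefl G v))) λ ()

  inTwoPairings⇒¬forcing : ∀ {u v} → InTwoPairings (adj G) u v → ¬ Forcing G u v
  inTwoPairings⇒¬forcing record { P = P ; Q = Q ; P-uv = P-uv ; Q-uv = Q-uv ; P≉Q = a , Pa≢Qa }
                         (_ , _ , unique) = Pa≢Qa (≡-sym (isYes-sound _ Qa≡Pa))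
    where
    Qa≡Pa : ⌊ partner Q a ≟ partner P a ⌋ ≡ true
    Qa≡Pa = trans (≡-sym (unique _ _ (pairing⇒perfectMatching P) (isYes-complete _ P-uv)
                                   (pairing⇒perfectMatching Q) (isYes-complete _ Q-uv) a (partner P a)))
                  (isYes-complete _ refl)

  everyEdgeInTwoPairings⇒noForcingEdge : EveryEdgeInTwoPairings (adj G) → NoForcingEdge G
  everyEdgeInTwoPairings⇒noForcingEdge two u v forcing@(uv , _) =
    inTwoPairings⇒¬forcing (two u v uv) forcing

module _ {V W : Set} {E : V → V → Bool} {F : W → W → Bool}
         (iso : V ↔ W) (E≡F : ∀ u v → E u v ≡ F (Inverse.to iso u) (Inverse.to iso v)) where
  open Inverse iso

  pullback : Pairing F → Pairing E
  pullback P = record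
    { partner     = from ∘ partner P ∘ to
    ; involutive  = λ v → begin
        from (partner P (to (from (partner P (to v))))) ≡⟨ cong (from ∘ partner P) (strictlyInverseˡ _) ⟩
        from (partner P (partner P (to v)))             ≡⟨ cong from (involutive P (to v)) ⟩
        from (to v)                                     ≡⟨ strictlyInverseʳ v ⟩
        v                                               ∎
    ; along-edges = λ v → begin
        E v (from (partner P (to v)))           ≡⟨ E≡F _ _ ⟩
        F (to v) (to (from (partner P (to v)))) ≡⟨ cong (F (to v)) (strictlyInverseˡ _) ⟩
        F (to v) (partner P (to v))             ≡⟨ along-edges P (to v) ⟩
        true                                    ∎
    }
    where open ≡-Reasoning

  pullback-≉ : ∀ {P Q} → P ≉ Q → pullback P ≉ pullback Q
  pullback-≉ {P} {Q} (w , Pw≢Qw) = from w , λ eq → Pw≢Qw (begin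
    partner P w                         ≡⟨ cong (partner P) (strictlyInverseˡ w) ⟨
    partner P (to (from w))             ≡⟨ strictlyInverseˡ _ ⟨
    to (from (partner P (to (from w)))) ≡⟨ cong to eq ⟩
    to (from (partner Q (to (from w)))) ≡⟨ strictlyInverseˡ _ ⟩
    partner Q (to (from w))             ≡⟨ cong (partner Q) (strictlyInverseˡ w) ⟩
    partner Q w                         ∎)
    where open ≡-Reasoning

  pullback-everyEdgeInTwoPairings : EveryEdgeInTwoPairings F → EveryEdgeInTwoPairings E
  pullback-everyEdgeInTwoPairings two u v uv = record
    { P = pullback P ; Q = pullback Q
    ; P-uv = trans (cong from P-uv) (strictlyInverseʳ v)
    ; Q-uv = trans (cong from Q-uv) (strictlyInverseʳ v)
    ; P≉Q = pullback-≉ {P} {Q} P≉Q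
    }
    where open InTwoPairings (two (to u) (to v) (trans (≡-sym (E≡F u v)) uv))

-- third i k = −(i + k) mod 3, the element of Fin 3 other than i and k when i ≢ k.
third : Fin 3 → Fin 3 → Fin 3
third zero             zero             = zero
third zero             (suc zero)       = # 2
third zero             (suc (suc zero)) = # 1
third (suc zero)       zero             = # 2
third (suc zero)       (suc zero)       = # 1
third (suc zero)       (suc (suc zero)) = zero
third (suc (suc zero)) zero             = # 1
third (suc (suc zero)) (suc zero)       = zero
third (suc (suc zero)) (suc (suc zero)) = # 2

third-cancelʳ : ∀ i k → third (third i k) k ≡ i
third-cancelʳ = toWitness {a? = all? λ i → all? λ k → third (third i k) k ≟ i} _

third-cancelˡ : ∀ i k → third i (third i k) ≡ k
third-cancelˡ = toWitness {a? = all? λ i → all? λ k → third i (third i k) ≟ k} _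

third-≢ˡ : ∀ {i k} → i ≢ k → third i k ≢ i
third-≢ˡ {i} {k} = toWitness {a? = all? λ i → all? λ k → ¬? (i ≟ k) →-dec ¬? (third i k ≟ i)} _ i k

third-≢ʳ : ∀ {i k} → i ≢ k → third i k ≢ k
third-≢ʳ {i} {k} = toWitness {a? = all? λ i → all? λ k → ¬? (i ≟ k) →-dec ¬? (third i k ≟ k)} _ i k

module YΔLift (G : Graph) (x : Fin (n G)) (y : Fin 3 → Fin (n G))
              (y-inj : ∀ i j → y i ≡ y j → i ≡ j)
              (y-adj : ∀ i → adj G x (y i) ≡ true)
              (y-all : ∀ v → adj G x v ≡ true → ∃ λ i → y i ≡ v) where

  V : Set
  V = YΔVertex G x

  y≢x : ∀ i → y i ≢ x
  y≢x i yi≡x =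
    contradiction (trans (≡-sym (y-adj i)) (trans (cong (adj G x) yi≡x) (irrefl G x))) λ ()

  -- No proof-irrelevance argument is needed: ⊥ is a record with an irrelevant field.
  old-≡ : ∀ {u v} {u≢x : u ≢ x} {v≢x : v ≢ x} →
          u ≡ v → _≡_ {A = V} (inj₁ (u , u≢x)) (inj₁ (v , v≢x))
  old-≡ refl = refl

  collapse : V → Fin (n G)
  collapse (inj₁ (u , _)) = u
  collapse (inj₂ _)       = x

  module _ (P : Pairing (adj G)) where

    spoke : Fin 3
    spoke = proj₁ (y-all (partner P x) (along-edges P x))

    y-spoke : y spoke ≡ partner P x
    y-spoke = proj₂ (y-all (partner P x) (along-edges P x))

    spoke-unique : ∀ {i} → partner P x ≡ y i → spoke ≡ i
    spoke-unique Px≡yi = y-inj _ _ (trans y-spoke Px≡yi)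

    liftPartner : V → V
    liftPartner (inj₁ (u , _)) with partner P u ≟ x
    ... | yes _   = inj₂ spoke
    ... | no Pu≢x = inj₁ (partner P u , Pu≢x)
    liftPartner (inj₂ i) with i ≟ spoke
    ... | yes _ = inj₁ (y spoke , y≢x spoke)
    ... | no _  = inj₂ (third i spoke)

    liftPartner-involutive : ∀ p → liftPartner (liftPartner p) ≡ p
    liftPartner-involutive (inj₁ (u , u≢x)) with partner P u ≟ x
    ... | yes Pu≡x with spoke ≟ spoke
    ...   | yes _   = old-≡ (trans y-spoke (partner-swap P Pu≡x))
    ...   | no s≢s  = contradiction refl s≢s
    liftPartner-involutive (inj₁ (u , u≢x)) | no _ with partner P (partner P u) ≟ x
    ...   | yes PPu≡x = contradiction (trans (≡-sym (involutive P u)) PPu≡x) u≢x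
    ...   | no _      = old-≡ (involutive P u)
    liftPartner-involutive (inj₂ i) with i ≟ spoke
    ... | yes i≡s with partner P (y spoke) ≟ x
    ...   | yes _       = cong inj₂ (≡-sym i≡s)
    ...   | no Pys≢x    = contradiction (partner-swap P (≡-sym y-spoke)) Pys≢x
    liftPartner-involutive (inj₂ i) | no i≢s with third i spoke ≟ spoke
    ...   | yes t≡s = contradiction t≡s (third-≢ʳ i≢s)
    ...   | no _    = cong inj₂ (third-cancelʳ i spoke)

    liftPartner-along-edges : ∀ p → YΔAdj G x y p (liftPartner p) ≡ true
    liftPartner-along-edges (inj₁ (u , _)) with partner P u ≟ x
    ... | yes Pu≡x = isYes-complete _ (≡-sym (trans y-spoke (partner-swap P Pu≡x)))
    ... | no _     = along-edges P u
    liftPartner-along-edges (inj₂ i) with i ≟ spoke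
    ... | yes i≡s = isYes-complete _ (cong y (≡-sym i≡s))
    ... | no i≢s  = cong not (isYes-incomplete _ (third-≢ˡ i≢s ∘ ≡-sym))

    collapse-liftPartner : ∀ u (u≢x : u ≢ x) → collapse (liftPartner (inj₁ (u , u≢x))) ≡ partner P u
    collapse-liftPartner u _ with partner P u ≟ x
    ... | yes Pu≡x = ≡-sym Pu≡x
    ... | no _     = refl

    liftPartner-old-old : ∀ {u v} (u≢x : u ≢ x) (v≢x : v ≢ x) →
                          partner P u ≡ v → liftPartner (inj₁ (u , u≢x)) ≡ inj₁ (v , v≢x)
    liftPartner-old-old {u} _ v≢x Pu≡v with partner P u ≟ x
    ... | yes Pu≡x = contradiction (trans (≡-sym Pu≡v) Pu≡x) v≢x
    ... | no _     = old-≡ Pu≡v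

    liftPartner-old-new : ∀ {u i} (u≢x : u ≢ x) → u ≡ y i →
                          partner P x ≡ y i → liftPartner (inj₁ (u , u≢x)) ≡ inj₂ i
    liftPartner-old-new {u} _ u≡yi Px≡yi with partner P u ≟ x
    ... | yes _    = cong inj₂ (spoke-unique Px≡yi)
    ... | no Pu≢x  = contradiction (trans (cong (partner P) u≡yi) (partner-swap P Px≡yi)) Pu≢x

    liftPartner-new-old : ∀ {u i} (u≢x : u ≢ x) → u ≡ y i →
                          partner P x ≡ y i → liftPartner (inj₂ i) ≡ inj₁ (u , u≢x)
    liftPartner-new-old {i = i} _ u≡yi Px≡yi with i ≟ spoke
    ... | yes i≡s = old-≡ (trans (cong y (≡-sym i≡s)) (≡-sym u≡yi))
    ... | no i≢s  = contradiction (≡-sym (spoke-unique Px≡yi)) i≢s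

    liftPartner-new-new : ∀ {i j} → i ≢ j →
                          partner P x ≡ y (third i j) → liftPartner (inj₂ i) ≡ inj₂ j
    liftPartner-new-new {i} {j} i≢j Px≡yt with i ≟ spoke
    ... | yes i≡s = contradiction (≡-sym (trans i≡s (spoke-unique Px≡yt))) (third-≢ˡ i≢j)
    ... | no _    = cong inj₂ (trans (cong (third i) (spoke-unique Px≡yt)) (third-cancelˡ i j))

  lift : Pairing (adj G) → Pairing (YΔAdj G x y)
  lift P = record
    { partner     = liftPartner P
    ; involutive  = liftPartner-involutive P
    ; along-edges = liftPartner-along-edges P
    }

  lift-≉ : ∀ {P Q} → P ≉ Q → lift P ≉ lift Q
  lift-≉ {P} {Q} P≉Q with ≉-away-from {P = P} {Q} x (partner-≢ G P x) P≉Q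
  ... | b , b≢x , Pb≢Qb = inj₁ (b , b≢x) , λ eq → Pb≢Qb (begin
    partner P b                                 ≡⟨ collapse-liftPartner P b b≢x ⟨
    collapse (liftPartner P (inj₁ (b , b≢x)))   ≡⟨ cong collapse eq ⟩
    collapse (liftPartner Q (inj₁ (b , b≢x)))   ≡⟨ collapse-liftPartner Q b b≢x ⟩
    partner Q b                                 ∎)
    where open ≡-Reasoning

  lift-through : ∀ p q → YΔAdj G x y p q ≡ true →
                 ∃₂ λ u v → adj G u v ≡ true × (∀ P → partner P u ≡ v → liftPartner P p ≡ q)
  lift-through (inj₁ (u , u≢x)) (inj₁ (v , v≢x)) uv =
    u , v , uv , λ P → liftPartner-old-old P u≢x v≢x
  lift-through (inj₁ (u , u≢x)) (inj₂ i) u≟yi =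
    x , y i , y-adj i , λ P → liftPartner-old-new P u≢x (isYes-sound _ u≟yi)
  lift-through (inj₂ i) (inj₁ (u , u≢x)) u≟yi =
    x , y i , y-adj i , λ P → liftPartner-new-old P u≢x (isYes-sound _ u≟yi)
  lift-through (inj₂ i) (inj₂ j) i≉j =
    x , y (third i j) , y-adj (third i j) , λ P → liftPartner-new-new P (isNo-sound _ i≉j)

  lift-everyEdgeInTwoPairings : EveryEdgeInTwoPairings (adj G) →
                                EveryEdgeInTwoPairings (YΔAdj G x y)
  lift-everyEdgeInTwoPairings two p q pq with lift-through p q pq
  ... | u , v , uv , lift-uv = record
    { P = lift P ; Q = lift Q
    ; P-uv = lift-uv P P-uv ; Q-uv = lift-uv Q Q-uv
    ; P≉Q = lift-≉ {P} {Q} P≉Q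
    }
    where open InTwoPairings (two u v uv)

YΔStep-everyEdgeInTwoPairings : ∀ {G G'} → YΔStep G G' →
  EveryEdgeInTwoPairings (adj G) → EveryEdgeInTwoPairings (adj G')
YΔStep-everyEdgeInTwoPairings {G} step =
  pullback-everyEdgeInTwoPairings iso iso-adj ∘
  YΔLift.lift-everyEdgeInTwoPairings G x y y-inj y-adj y-all
  where open YΔStep step

IsBase-everyEdgeInTwoPairings : ∀ {H G} → IsBase H G →
  EveryEdgeInTwoPairings (adj H) → EveryEdgeInTwoPairings (adj G)
IsBase-everyEdgeInTwoPairings [ step ]      = YΔStep-everyEdgeInTwoPairings step
IsBase-everyEdgeInTwoPairings (step ∷ base) =
  IsBase-everyEdgeInTwoPairings base ∘ YΔStep-everyEdgeInTwoPairings step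

-- Row k lists the partners of the vertices 0 … 11 in the k-th perfect matching of R₀;
-- these are all eight of them.
R₀-partners : Vec (Vec (Fin 12) 12) 8
R₀-partners =
  (# 1 ∷ # 0 ∷ # 9 ∷ # 4 ∷ # 3 ∷ # 10 ∷ # 7 ∷ # 6 ∷ # 11 ∷ # 2 ∷ # 5 ∷ # 8 ∷ []) ∷
  (# 1 ∷ # 0 ∷ # 9 ∷ # 5 ∷ # 7 ∷ # 3 ∷ # 8 ∷ # 4 ∷ # 6 ∷ # 2 ∷ # 11 ∷ # 10 ∷ []) ∷
  (# 2 ∷ # 6 ∷ # 0 ∷ # 4 ∷ # 3 ∷ # 10 ∷ # 1 ∷ # 8 ∷ # 7 ∷ # 11 ∷ # 5 ∷ # 9 ∷ []) ∷
  (# 2 ∷ # 6 ∷ # 0 ∷ # 5 ∷ # 7 ∷ # 3 ∷ # 1 ∷ # 4 ∷ # 11 ∷ # 10 ∷ # 9 ∷ # 8 ∷ []) ∷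
  (# 3 ∷ # 2 ∷ # 1 ∷ # 0 ∷ # 5 ∷ # 4 ∷ # 7 ∷ # 6 ∷ # 11 ∷ # 10 ∷ # 9 ∷ # 8 ∷ []) ∷
  (# 3 ∷ # 2 ∷ # 1 ∷ # 0 ∷ # 7 ∷ # 10 ∷ # 8 ∷ # 4 ∷ # 6 ∷ # 11 ∷ # 5 ∷ # 9 ∷ []) ∷
  (# 3 ∷ # 6 ∷ # 9 ∷ # 0 ∷ # 5 ∷ # 4 ∷ # 1 ∷ # 8 ∷ # 7 ∷ # 2 ∷ # 11 ∷ # 10 ∷ []) ∷
  (# 3 ∷ # 6 ∷ # 9 ∷ # 0 ∷ # 7 ∷ # 10 ∷ # 1 ∷ # 4 ∷ # 11 ∷ # 2 ∷ # 5 ∷ # 8 ∷ []) ∷ []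

R₀-partner : Fin 8 → Fin 12 → Fin 12
R₀-partner k = lookup (lookup R₀-partners k)

R₀-pairing : Fin 8 → Pairing R₀adj
R₀-pairing k = record
  { partner     = R₀-partner k
  ; involutive  = toWitness {a? = all? λ k → all? λ v → R₀-partner k (R₀-partner k v) ≟ v} _ k
  ; along-edges = toWitness {a? = all? λ k → all? λ v → R₀adj v (R₀-partner k v) ≟ᵇ true} _ k
  }

R₀-edge-in-two : ∀ u v → R₀adj u v ≡ true →
                 ∃₂ λ i j → R₀-partner i u ≡ v × R₀-partner j u ≡ v × R₀-pairing i ≉ R₀-pairing j
R₀-edge-in-two = toWitness {a? = all? λ u → all? λ v → (R₀adj u v ≟ᵇ true) →-dec
  any? λ i → any? λ j → (R₀-partner i u ≟ v) ×-dec (R₀-partner j u ≟ v) ×-dec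
  any? λ a → ¬? (R₀-partner i a ≟ R₀-partner j a)} _

R₀-everyEdgeInTwoPairings : EveryEdgeInTwoPairings R₀adj
R₀-everyEdgeInTwoPairings u v uv = inTwoPairings (R₀-edge-in-two u v uv)
  where
  inTwoPairings : (∃₂ λ i j → R₀-partner i u ≡ v × R₀-partner j u ≡ v ×
                                R₀-pairing i ≉ R₀-pairing j) →
                  InTwoPairings R₀adj u v
  inTwoPairings (i , j , Pi-uv , Pj-uv , Pi≉Pj) =
    record { P = R₀-pairing i ; Q = R₀-pairing j ; P-uv = Pi-uv ; Q-uv = Pj-uv ; P≉Q = Pi≉Pj }

proposition2 : NoForcingEdge R₀ × (∀ G → IsBase R₀ G → NoForcingEdge G)
proposition2 =
  everyEdgeInTwoPairings⇒noForcingEdge R₀ R₀-everyEdgeInTwoPairings ,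
  λ G base → everyEdgeInTwoPairings⇒noForcingEdge G
                (IsBase-everyEdgeInTwoPairings base R₀-everyEdgeInTwoPairings)
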